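{- Let $n,m$ be positive integers and $a_1,\dots,a_m\in\{0,1\}$, and suppose the Toeplitz graph $G_n(a_1a_2\cdots a_m)$ is word-representable. Then for each positive divisor $d$ of $m$, the Toeplitz graph $G_{\lfloor n/d\rfloor}(a_da_{2d}\cdots a_m)$ is word-representable.
   Context: For a word $b_1b_2\cdots b_p$ over $\{0,1\}$, the Toeplitz graph $G_N(b_1b_2\cdots b_p)$ is the simple graph on vertex set $[N]=\{1,\dots,N\}$ in which distinct vertices $x,y$ are adjacent if and only if $b_r=1$, where $r\in[p]$ is such that $r\equiv |x-y|\pmod p$. (Equivalently it is the Riordan graph $G_N\big(\frac{b_1+b_2z+\cdots+b_pz^{p-1}}{1-z^p},z\big)$.) The word $a_da_{2d}\cdots a_m$ has length $m/d$. Two distinct letters $x,y$ alternate in a word $w$ if deleting all other letters from $w$ yields a word of the form $xyxy\cdots$ or $yxyx\cdots$ (of even or odd length). A graph $G=(V,E)$ is word-representable if there is a word $w$ over the alphabet $V$ such that for all distinct $x,y\in V$, $x$ and $y$ alternate in $w$ if and only if $xy\in E$. -}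

module Defs where

open import Data.Nat using (ℕ; zero; suc; _+_; _*_; _∸_; _<?_; ∣_-_∣)
open import Data.Fin using (Fin; toℕ; fromℕ<) renaming (_≟_ to _≟F_)
open import Data.Bool using (Bool; true; false; _∨_; if_then_else_)
open import Data.List using (List; []; _∷_)
open import Data.List.Membership.Propositional using (_∈_)
open import Data.Product using (Σ; ∃; _×_)
open import Data.Unit using (⊤)
open import Relation.Nullary using (¬_; yes; no)
open import Relation.Nullary.Decidable using (⌊_⌋)
open import Relation.Binary.PropositionalEquality using (_≡_; _≢_)
open import Function.Bundles using (_⇔_)

-- A word b₁ b₂ ⋯ b_p over {0,1} is a function Fin p → Bool;
-- letter r (1-indexed, r ∈ [p]) is  b (r - 1),  with true = 1.
BinWord : ℕ → Set
BinWord p = Fin p → Bool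

-- 1-indexed access a_i (only used for 1 ≤ i ≤ p; value false outside).
letter : {p : ℕ} → BinWord p → ℕ → Bool
letter {p} a zero = false
letter {p} a (suc i) with i <? p
... | yes i<p = a (fromℕ< i<p)
... | no _ = false

-- The word a_d a_{2d} ⋯ a_m of length q, where m = q·d:
-- its j-th letter (j = 1..q) is a_{j·d}.
subword : {m : ℕ} → BinWord m → (d q : ℕ) → BinWord q
subword a d q j = letter a (suc (toℕ j) * d)

-- Vertices of G_N are Fin N (vertex i ∈ Fin N represents i+1 ∈ [N];
-- differences are unaffected).
ToeplitzAdj : (N p : ℕ) → BinWord p → Fin N → Fin N → Set
ToeplitzAdj N p b x y =
  x ≢ y × Σ (Fin p) (λ r → (∃ λ k → ∣ toℕ x - toℕ y ∣ ≡ suc (toℕ r) + k * p)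
                          × b r ≡ true)

restrict : {N : ℕ} → Fin N → Fin N → List (Fin N) → List (Fin N)
restrict x y [] = []
restrict x y (z ∷ w) =
  if ⌊ z ≟F x ⌋ ∨ ⌊ z ≟F y ⌋ then z ∷ restrict x y w else restrict x y w

NoConsecRepeat : {A : Set} → List A → Set
NoConsecRepeat [] = ⊤
NoConsecRepeat (a ∷ []) = ⊤
NoConsecRepeat (a ∷ b ∷ w) = a ≢ b × NoConsecRepeat (b ∷ w)

Alternate : {N : ℕ} → List (Fin N) → Fin N → Fin N → Set
Alternate w x y = NoConsecRepeat (restrict x y w)

WordRepresentable : (N : ℕ) → (Fin N → Fin N → Set) → Set
WordRepresentable N E =
  Σ (List (Fin N)) λ w →
    (∀ x → x ∈ w) ×
    (∀ x y → x ≢ y → (Alternate w x y ⇔ E x y))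

-- The vertices d, 2d, …, ⌊n/d⌋d of G_n(a₁⋯a_m) induce a copy of
-- G_⌊n/d⌋(a_d a_{2d} ⋯ a_m): their pairwise differences are the multiples δd
-- of d, and δd ≡ s (mod m) with d ∣ m forces d ∣ s, so the letter of a read at
-- δd is the letter of the subword read at δ. Induced subgraphs of
-- word-representable graphs are word-representable: delete from the
-- representing word every letter outside the subgraph.
module Submission where

open import Defs
open import Data.Nat using (ℕ; zero; suc; _+_; _*_; _<_; _≤_; _<?_; _/_; ∣_-_∣; NonZero)
open import Data.Nat.Properties
open import Data.Nat.DivMod using (m/n*n≤m)
open import Data.Nat.Divisibility using (_∣_; quotient; divides; ∣m+n∣m⇒∣n; n∣m*n; ∣-trans)
open import Data.Nat.Solver using (module +-*-Solver)
open import Data.Fin using (Fin; toℕ; fromℕ<) renaming (_≟_ to _≟F_)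
open import Data.Fin.Properties using (any?; toℕ-fromℕ<; fromℕ<-toℕ; toℕ<n; toℕ-injective)
open import Data.Bool using (true; false; _∨_; if_then_else_)
open import Data.Maybe using (Maybe; just; nothing)
open import Data.List using ([]; _∷_; map; mapMaybe)
open import Data.List.Membership.Propositional using (_∈_)
open import Data.List.Relation.Unary.Any using (here; there)
open import Data.Product using (Σ; ∃; _×_; _,_)
open import Data.Unit using (tt)
open import Data.Empty using (⊥-elim; ⊥-elim-irr)
open import Function using (_∘_)
open import Function.Bundles using (_⇔_; mk⇔; Equivalence)
open import Function.Definitions using (Injective)
open import Relation.Nullary using (yes; no)
open import Relation.Nullary.Decidable using (⌊_⌋)
open import Relation.Binary.PropositionalEquality

open Equivalence using (to; from)

private
  variable
    A B : Set
    k n : ℕ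

NoConsecRepeat-map⁺ : {f : A → B} → Injective _≡_ _≡_ f →
                      ∀ l → NoConsecRepeat l → NoConsecRepeat (map f l)
NoConsecRepeat-map⁺ f-inj []          _            = tt
NoConsecRepeat-map⁺ f-inj (_ ∷ [])    _            = tt
NoConsecRepeat-map⁺ f-inj (_ ∷ b ∷ l) (a≢b , rest) =
  a≢b ∘ f-inj , NoConsecRepeat-map⁺ f-inj (b ∷ l) rest

NoConsecRepeat-map⁻ : (f : A → B) → ∀ l → NoConsecRepeat (map f l) → NoConsecRepeat l
NoConsecRepeat-map⁻ f []          _              = tt
NoConsecRepeat-map⁻ f (_ ∷ [])    _              = tt
NoConsecRepeat-map⁻ f (_ ∷ b ∷ l) (fa≢fb , rest) =
  fa≢fb ∘ cong f , NoConsecRepeat-map⁻ f (b ∷ l) rest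

⌊≟⌋-injective : {f : Fin k → Fin n} → Injective _≡_ _≡_ f →
                ∀ i j → ⌊ i ≟F j ⌋ ≡ ⌊ f i ≟F f j ⌋
⌊≟⌋-injective {f = f} f-inj i j with i ≟F j | f i ≟F f j
... | yes _   | yes _     = refl
... | yes i≡j | no fi≢fj  = ⊥-elim (fi≢fj (cong f i≡j))
... | no i≢j  | yes fi≡fj = ⊥-elim (i≢j (f-inj fi≡fj))
... | no _    | no _      = refl

restrict-map : {f : Fin k → Fin n} → Injective _≡_ _≡_ f → ∀ x y l →
               map f (restrict x y l) ≡ restrict (f x) (f y) (map f l)
restrict-map f-inj x y [] = refl
restrict-map {f = f} f-inj x y (z ∷ l)
  rewrite ⌊≟⌋-injective f-inj z x | ⌊≟⌋-injective f-inj z y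
  with ⌊ f z ≟F f x ⌋ ∨ ⌊ f z ≟F f y ⌋
... | true  = cong (f z ∷_) (restrict-map f-inj x y l)
... | false = restrict-map f-inj x y l

restrict-∷-cong : ∀ {x y : Fin n} z l l′ → restrict x y l ≡ restrict x y l′ →
                  restrict x y (z ∷ l) ≡ restrict x y (z ∷ l′)
restrict-∷-cong z _ _ = cong (λ r → if _ then z ∷ r else r)

restrict-∷-skip : ∀ {x y z : Fin n} l → z ≢ x → z ≢ y → restrict x y (z ∷ l) ≡ restrict x y l
restrict-∷-skip {x = x} {y} {z} l z≢x z≢y with z ≟F x | z ≟F y
... | yes z≡x | _       = ⊥-elim (z≢x z≡x)
... | no _    | yes z≡y = ⊥-elim (z≢y z≡y)
... | no _    | no _    = refl

module Preimage {f : Fin k → Fin n} (f-inj : Injective _≡_ _≡_ f) where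

  preimage : Fin n → Maybe (Fin k)
  preimage z with any? (λ j → f j ≟F z)
  ... | yes (j , _) = just j
  ... | no _        = nothing

  preimage-just : ∀ {z j} → preimage z ≡ just j → f j ≡ z
  preimage-just {z} eq with any? (λ j → f j ≟F z)
  preimage-just refl | yes (_ , fj≡z) = fj≡z

  preimage-nothing : ∀ {z} → preimage z ≡ nothing → ∀ j → f j ≢ z
  preimage-nothing {z} eq j fj≡z with any? (λ j → f j ≟F z)
  preimage-nothing {z} () j fj≡z | yes _
  preimage-nothing {z} eq j fj≡z | no ∄j = ∄j (j , fj≡z)

  preimage-image : ∀ j → preimage (f j) ≡ just j
  preimage-image j with any? (λ i → f i ≟F f j)
  ... | yes (i , fi≡fj) = cong just (f-inj fi≡fj)
  ... | no ∄i           = ⊥-elim (∄i (j , refl))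

  ∈-mapMaybe-preimage : ∀ {j} w → f j ∈ w → j ∈ mapMaybe preimage w
  ∈-mapMaybe-preimage {j} (z ∷ w) (here refl) rewrite preimage-image j = here refl
  ∈-mapMaybe-preimage (z ∷ w) (there fj∈w) with preimage z
  ... | just _  = there (∈-mapMaybe-preimage w fj∈w)
  ... | nothing = ∈-mapMaybe-preimage w fj∈w

  restrict-image : ∀ x y w →
                   restrict (f x) (f y) (map f (mapMaybe preimage w)) ≡ restrict (f x) (f y) w
  restrict-image x y [] = refl
  restrict-image x y (z ∷ w) with preimage z in eq
  ... | just j rewrite preimage-just eq =
    restrict-∷-cong z (map f (mapMaybe preimage w)) w (restrict-image x y w)
  ... | nothing = trans (restrict-image x y w)
    (sym (restrict-∷-skip {x = f x} {f y} w (preimage-nothing eq x ∘ sym) (preimage-nothing eq y ∘ sym)))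

  alternate-preimage : ∀ w x y → Alternate (mapMaybe preimage w) x y ⇔ Alternate w (f x) (f y)
  alternate-preimage w x y = mk⇔
    (λ alt → subst NoConsecRepeat restrict-preimage (NoConsecRepeat-map⁺ f-inj _ alt))
    (λ alt → NoConsecRepeat-map⁻ f _ (subst NoConsecRepeat (sym restrict-preimage) alt))
    where
    restrict-preimage : map f (restrict x y (mapMaybe preimage w)) ≡ restrict (f x) (f y) w
    restrict-preimage = trans (restrict-map f-inj x y (mapMaybe preimage w)) (restrict-image x y w)

wordRepresentable-induced : {E : Fin n → Fin n → Set} {E′ : Fin k → Fin k → Set}
                            (f : Fin k → Fin n) → Injective _≡_ _≡_ f →
                            (∀ x y → x ≢ y → E′ x y ⇔ E (f x) (f y)) →
                            WordRepresentable n E → WordRepresentable k E′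
wordRepresentable-induced f f-inj E′⇔E (w , w-covers , w-represents) =
  mapMaybe preimage w , (λ x → ∈-mapMaybe-preimage w (w-covers (f x))) , represents
  where
  open Preimage f-inj
  represents : ∀ x y → x ≢ y → Alternate (mapMaybe preimage w) x y ⇔ _
  represents x y x≢y = mk⇔
    (from (E′⇔E x y x≢y) ∘ to w-represents′ ∘ to (alternate-preimage w x y))
    (from (alternate-preimage w x y) ∘ from w-represents′ ∘ to (E′⇔E x y x≢y))
    where w-represents′ = w-represents (f x) (f y) (x≢y ∘ f-inj)

-- ToeplitzAdj N p b x y unfolds to  x ≢ y × IsJump p b ∣ toℕ x - toℕ y ∣.
IsJump : (p : ℕ) → BinWord p → ℕ → Set
IsJump p b δ = Σ (Fin p) λ r → (∃ λ t → δ ≡ suc (toℕ r) + t * p) × b r ≡ true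

letter-fromℕ< : ∀ {p} (b : BinWord p) i (i<p : i < p) → letter b (suc i) ≡ b (fromℕ< i<p)
letter-fromℕ< {p} b i i<p with i <? p
... | yes _   = refl
... | no i≮p = ⊥-elim (i≮p i<p)

*-distribʳ-residue : ∀ s t q D → (s + t * q) * D ≡ s * D + t * (q * D)
*-distribʳ-residue = solve 4 (λ s t q D → (s :+ t :* q) :* D := s :* D :+ t :* (q :* D)) refl
  where open +-*-Solver

jump-divisible : ∀ c q δ r t → δ * suc c ≡ suc r + t * (q * suc c) →
                 ∃ λ s → suc r ≡ suc s * suc c
jump-divisible c q δ r t eq
  with ∣m+n∣m⇒∣n (subst (suc c ∣_) (trans eq (+-comm (suc r) _)) (n∣m*n δ))
                 (∣-trans (n∣m*n q) (n∣m*n t))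
... | divides (suc s) sr≡ = s , sr≡

isJump-scale : ∀ c q (a : BinWord (q * suc c)) δ →
               IsJump q (subword a (suc c) q) δ ⇔ IsJump (q * suc c) a (δ * suc c)
isJump-scale c q a δ = mk⇔ scale unscale
  where
  D = suc c

  scale : IsJump q (subword a D q) δ → IsJump (q * D) a (δ * D)
  scale (r , (t , δ≡) , bit) = fromℕ< i<qD , (t , δD≡) , trans (sym (letter-fromℕ< a i i<qD)) bit
    where
    i = c + toℕ r * D
    i<qD : i < q * D
    i<qD = *-monoˡ-≤ D (toℕ<n r)
    δD≡ : δ * D ≡ suc (toℕ (fromℕ< i<qD)) + t * (q * D)
    δD≡ = begin
      δ * D                             ≡⟨ cong (_* D) δ≡ ⟩
      (suc (toℕ r) + t * q) * D         ≡⟨ *-distribʳ-residue (suc (toℕ r)) t q D ⟩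
      suc i + t * (q * D)               ≡⟨ cong (λ j → suc j + t * (q * D)) (toℕ-fromℕ< i<qD) ⟨
      suc (toℕ (fromℕ< i<qD)) + t * (q * D) ∎
      where open ≡-Reasoning

  unscale : IsJump (q * D) a (δ * D) → IsJump q (subword a D q) δ
  unscale (r , (t , δD≡) , bit) with jump-divisible c q δ (toℕ r) t δD≡
  ... | s , r≡ = fromℕ< s<q , (t , δ≡) , bit′
    where
    s<q : s < q
    s<q = *-cancelʳ-≤ (suc s) q D (subst (_≤ q * D) r≡ (toℕ<n r))
    δ≡ : δ ≡ suc (toℕ (fromℕ< s<q)) + t * q
    δ≡ = *-cancelʳ-≡ δ _ D (begin
      δ * D                          ≡⟨ δD≡ ⟩
      suc (toℕ r) + t * (q * D)      ≡⟨ cong (_+ t * (q * D)) r≡ ⟩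
      suc s * D + t * (q * D)        ≡⟨ *-distribʳ-residue (suc s) t q D ⟨
      (suc s + t * q) * D            ≡⟨ cong (λ j → (suc j + t * q) * D) (toℕ-fromℕ< s<q) ⟨
      (suc (toℕ (fromℕ< s<q)) + t * q) * D ∎)
      where open ≡-Reasoning
    bit′ : subword a D q (fromℕ< s<q) ≡ true
    bit′ = begin
      letter a (suc (toℕ (fromℕ< s<q)) * D) ≡⟨ cong (λ j → letter a (suc j * D)) (toℕ-fromℕ< s<q) ⟩
      letter a (suc s * D)                  ≡⟨ cong (letter a) r≡ ⟨
      letter a (suc (toℕ r))                ≡⟨ letter-fromℕ< a (toℕ r) (toℕ<n r) ⟩
      a (fromℕ< (toℕ<n r))                  ≡⟨ cong a (fromℕ<-toℕ r (toℕ<n r)) ⟩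
      a r                                   ≡⟨ bit ⟩
      true                                  ∎
      where open ≡-Reasoning

-- Vertex j of G_⌊n/d⌋ is sent to vertex c + j·d of G_n, i.e. (j+1)·d in the
-- paper's 1-indexed numbering, where d = suc c.
module _ (n c : ℕ) where

  multiple : Fin (n / suc c) → Fin n
  multiple j = fromℕ< (≤-trans (*-monoˡ-≤ (suc c) (toℕ<n j)) (m/n*n≤m n (suc c)))

  toℕ-multiple : ∀ j → toℕ (multiple j) ≡ c + toℕ j * suc c
  toℕ-multiple j = toℕ-fromℕ< _

  multiple-injective : Injective _≡_ _≡_ multiple
  multiple-injective {i} {j} eq = toℕ-injective (*-cancelʳ-≡ (toℕ i) (toℕ j) (suc c)
    (+-cancelˡ-≡ c _ _ (trans (sym (toℕ-multiple i)) (trans (cong toℕ eq) (toℕ-multiple j)))))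

  ∣multiple-multiple∣ : ∀ i j → ∣ toℕ (multiple i) - toℕ (multiple j) ∣ ≡ ∣ toℕ i - toℕ j ∣ * suc c
  ∣multiple-multiple∣ i j = begin
    ∣ toℕ (multiple i) - toℕ (multiple j) ∣    ≡⟨ cong₂ ∣_-_∣ (toℕ-multiple i) (toℕ-multiple j) ⟩
    ∣ c + toℕ i * suc c - c + toℕ j * suc c ∣  ≡⟨ ∣m+n-m+o∣≡∣n-o∣ c _ _ ⟩
    ∣ toℕ i * suc c - toℕ j * suc c ∣          ≡⟨ *-distribʳ-∣-∣ (suc c) (toℕ i) (toℕ j) ⟨
    ∣ toℕ i - toℕ j ∣ * suc c                  ∎
    where open ≡-Reasoning

  toeplitzAdj-multiple : ∀ q (a : BinWord (q * suc c)) x y → x ≢ y →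
                         ToeplitzAdj (n / suc c) q (subword a (suc c) q) x y ⇔
                         ToeplitzAdj n (q * suc c) a (multiple x) (multiple y)
  toeplitzAdj-multiple q a x y x≢y = mk⇔
    (λ (_ , jump) → x≢y ∘ multiple-injective ,
                    subst (IsJump _ a) (sym (∣multiple-multiple∣ x y)) (to (isJump-scale c q a _) jump))
    (λ (_ , jump) → x≢y ,
                    from (isJump-scale c q a _) (subst (IsJump _ a) (∣multiple-multiple∣ x y) jump))

theorem9 : (n m : ℕ) → 0 < n → 0 < m → (a : BinWord m) →
           WordRepresentable n (ToeplitzAdj n m a) →
           (d : ℕ) .{{_ : NonZero d}} → (d∣m : d ∣ m) →
           WordRepresentable (n / d)
             (ToeplitzAdj (n / d) (quotient d∣m) (subword a d (quotient d∣m)))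
theorem9 n m _ _ a _ zero {{d≢0}} _ = ⊥-elim-irr (NonZero.nonZero d≢0)
theorem9 n .(q * suc c) _ _ a represented (suc c) (divides q refl) =
  wordRepresentable-induced (multiple n c) (multiple-injective n c) (toeplitzAdj-multiple n c q a)
    represented
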